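{- Let $k\geq 3$ and let $G$ be a total $k$-uniform graph with no isolated vertices. If $uv\in E(G)$, then $G\setminus (N[u]\cup N[v])$ is a total $(k-2)$-uniform graph with no isolated vertex.
   Context: All graphs are finite and simple. $N(v)$ is the set of neighbors of $v$ and $N[v]=N(v)\cup\{v\}$; $G\setminus S$ denotes the graph obtained by deleting the vertices of $S$. For a graph $G$ with no isolated vertices, a set $A\subseteq V(G)$ is a total dominating set if every vertex of $G$ has a neighbor in $A$; $\gamma_t(G)$ is the minimum size of a total dominating set. A sequence $(v_1,\dots,v_m)$ of distinct vertices is legal if $N(v_i)\setminus\bigcup_{j=1}^{i-1}N(v_j)\neq\emptyset$ for every $i\in\{2,\dots,m\}$; it is a total dominating sequence if moreover $\{v_1,\dots,v_m\}$ is a total dominating set. $\gamma_{gr}^t(G)$ is the maximum length of a total dominating sequence. A graph $G$ with no isolated vertices is total $k$-uniform if $\gamma_t(G)=\gamma_{gr}^t(G)=k$. -}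

module Defs where

open import Data.Nat using (ℕ; _≤_; _<_)
open import Data.Bool using (Bool; true; false; _∨_)
open import Data.Fin using (Fin; toℕ; _≟_)
open import Data.Fin.Subset using (Subset; _∈_; _⊆_; ∣_∣; ∁; _∪_)
open import Data.Vec using (tabulate)
open import Data.List using (List; length; lookup; take)
import Data.List.Membership.Propositional as LM
open import Data.List.Relation.Unary.All using (All)
open import Data.List.Relation.Unary.Unique.Propositional using (Unique)
open import Data.Product using (Σ; ∃; _×_)
open import Relation.Binary.PropositionalEquality using (_≡_)
open import Relation.Nullary using (¬_)
open import Relation.Nullary.Decidable using (⌊_⌋)

record Graph (n : ℕ) : Set where
  field
    adj    : Fin n → Fin n → Bool
    sym    : ∀ u v → adj u v ≡ adj v u
    irrefl : ∀ v → adj v v ≡ false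
open Graph public

Adj : ∀ {n} → Graph n → Fin n → Fin n → Set
Adj G u v = adj G u v ≡ true

ClosedNbhd : ∀ {n} → Graph n → Fin n → Subset n
ClosedNbhd G u = tabulate (λ w → ⌊ w ≟ u ⌋ ∨ adj G u w)

-- Throughout, W : Subset n is a vertex set and all notions refer to the
-- induced subgraph G[W] (so G \ S is G[∁ S]).  In G[W], the neighbours of
-- v are the vertices w ∈ W with Adj G v w.

NoIsolated : ∀ {n} → Graph n → Subset n → Set
NoIsolated G W = ∀ v → v ∈ W → ∃ λ w → w ∈ W × Adj G v w

TotDominated : ∀ {n} → Graph n → Subset n → (Fin n → Set) → Set
TotDominated G W P = ∀ v → v ∈ W → ∃ λ a → P a × Adj G v a

IsTDS : ∀ {n} → Graph n → Subset n → Subset n → Set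
IsTDS G W A = A ⊆ W × TotDominated G W (λ a → a ∈ A)

-- legality: for every i ≥ 2 (0-based index i ≥ 1), v_i has a neighbour in
-- G[W] that is not a neighbour of any earlier v_j.
Legal : ∀ {n} → Graph n → Subset n → List (Fin n) → Set
Legal G W xs = ∀ (i : Fin (length xs)) → 0 < toℕ i →
  ∃ λ w → w ∈ W × Adj G (lookup xs i) w ×
    All (λ y → ¬ Adj G y w) (take (toℕ i) xs)

IsTDSeq : ∀ {n} → Graph n → Subset n → List (Fin n) → Set
IsTDSeq G W xs =
  Unique xs × All (λ x → x ∈ W) xs × Legal G W xs ×
  TotDominated G W (λ a → a LM.∈ xs)

GammaT≡ : ∀ {n} → Graph n → Subset n → ℕ → Set
GammaT≡ G W k =
  (∃ λ A → IsTDS G W A × ∣ A ∣ ≡ k) × (∀ A → IsTDS G W A → k ≤ ∣ A ∣)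

GammaGrT≡ : ∀ {n} → Graph n → Subset n → ℕ → Set
GammaGrT≡ G W k =
  (∃ λ xs → IsTDSeq G W xs × length xs ≡ k) ×
  (∀ xs → IsTDSeq G W xs → length xs ≤ k)

TotalUniform : ∀ {n} → Graph n → Subset n → ℕ → Set
TotalUniform G W k = NoIsolated G W × GammaT≡ G W k × GammaGrT≡ G W k

{-# OPTIONS --safe #-}
module Submission where

-- In a graph without isolated vertices every legal sequence of distinct vertices extends greedily
-- to a total dominating sequence; so if G is total k-uniform, legal sequences have length at most
-- k and total dominating sequences length at least k.  Let W = V ∖ (N[u] ∪ N[v]).  A vertex x of
-- W without neighbours in W has N(x) ⊆ N(u) ∪ N(v), so (x, u, v) followed by a greedy extension
-- of (u, v) would be legal of length k + 1.  Prefixing (u, v) to a total dominating sequence of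
-- G[W] gives a legal sequence of G, hence γgrₜ(G[W]) ≤ k − 2; adding u, v to a total dominating
-- set of G[W] gives one of G, hence γₜ(G[W]) ≥ k − 2; and γₜ ≤ γgrₜ closes the gap.

open import Defs
open import Data.Bool using (true; false; _∨_)
import Data.Bool as Bool
open import Data.Empty using (⊥-elim)
open import Data.Fin using (Fin; toℕ; zero; suc; _≟_)
open import Data.Fin.Properties using (any?; pigeonhole)
open import Data.Fin.Subset using (Subset; ⊤; ∁; _∪_; _∈_; _∉_; ⁅_⁆; ∣_∣) renaming (⊥ to ∅)
open import Data.Fin.Subset.Properties
  using (∈⊤; x∈p∪q⁻; x∈p∪q⁺; x∈⁅x⁆; x∈⁅y⁆⇒x≡y; x∈∁p⇒x∉p; x∉∁p⇒x∈p; ∣⁅x⁆∣≡1; ∉⊥; ∣⊥∣≡0)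
  renaming (_∈?_ to _∈ˢ?_)
open import Data.List using (List; []; _∷_; _++_; [_]; _∷ʳ_; length; lookup; take)
import Data.List.Membership.Propositional as List
open import Data.List.Membership.Propositional.Properties using (∈-lookup)
open import Data.List.Properties using (length-++; ++-assoc; ++-identityʳ; length-++-≤ˡ)
open import Data.List.Relation.Unary.All using (All; []; _∷_; all?) renaming (lookup to All-lookup)
import Data.List.Relation.Unary.All as All
open import Data.List.Relation.Unary.All.Properties using (¬Any⇒All¬) renaming (++⁺ to All-++⁺)
open import Data.List.Relation.Unary.Any using (here; there; index) renaming (any? to anyˡ?)
open import Data.List.Relation.Unary.Any.Properties using (lookup-index)
open import Data.List.Relation.Unary.Unique.Propositional using (Unique; []; _∷_)
open import Data.List.Relation.Unary.Unique.Propositional.Properties using () renaming (++⁺ to Unique-++⁺)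
open import Data.Nat using (ℕ; zero; suc; _≤_; _<_; _+_; _∸_; z≤n; s≤s; _≤?_)
open import Data.Nat.Properties
  using (≤-antisym; ≤-reflexive; ≤-trans; <⇒≱; <⇒≢; ≰⇒>; n<1+n; n≤1+n; m≤n+m; +-suc; +-identityʳ; +-assoc; +-monoʳ-≤; ∸-monoˡ-≤)
open import Data.Product using (∃; _×_; _,_)
open import Data.Sum using (_⊎_; inj₁; inj₂)
open import Data.Vec using ([]; _∷_)
open import Data.Vec.Properties using (lookup∘tabulate; []=⇒lookup; lookup⇒[]=)
open import Function using (_∘_)
open import Relation.Binary.PropositionalEquality using (_≡_; refl; trans; cong; subst) renaming (sym to ≡-sym)
open import Relation.Nullary using (¬_; Dec; yes; no)
open import Relation.Nullary.Decidable using (⌊_⌋; ¬?; _×-dec_)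

module _ {n} (G : Graph n) where

  Adj-sym : ∀ {a b} → Adj G a b → Adj G b a
  Adj-sym {a} {b} ab = trans (sym G b a) ab

  Adj-irrefl : ∀ {a} → ¬ Adj G a a
  Adj-irrefl {a} aa with trans (≡-sym aa) (irrefl G a)
  ... | ()

  Adj? : ∀ a b → Dec (Adj G a b)
  Adj? a b = adj G a b Bool.≟ true

  ∈-ClosedNbhd⁻ : ∀ {u y} → y ∈ ClosedNbhd G u → y ≡ u ⊎ Adj G u y
  ∈-ClosedNbhd⁻ {u} {y} p with y ≟ u | trans (≡-sym (lookup∘tabulate _ y)) ([]=⇒lookup p)
  ... | yes y≡u | _  = inj₁ y≡u
  ... | no _    | uy = inj₂ uy

  ∈-ClosedNbhd⁺ : ∀ {u y} → y ≡ u ⊎ Adj G u y → y ∈ ClosedNbhd G u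
  ∈-ClosedNbhd⁺ {u} {y} q = lookup⇒[]= y _ (trans (lookup∘tabulate _ y) (value q))
    where
    value : y ≡ u ⊎ Adj G u y → ⌊ y ≟ u ⌋ ∨ adj G u y ≡ true
    value q with y ≟ u
    value q          | yes _   = refl
    value (inj₁ y≡u) | no y≢u = ⊥-elim (y≢u y≡u)
    value (inj₂ uy)  | no _    = uy

∣p∪q∣≤∣p∣+∣q∣ : ∀ {n} (p q : Subset n) → ∣ p ∪ q ∣ ≤ ∣ p ∣ + ∣ q ∣
∣p∪q∣≤∣p∣+∣q∣ []           []           = z≤n
∣p∪q∣≤∣p∣+∣q∣ (true  ∷ p) (true  ∷ q) = s≤s (≤-trans (∣p∪q∣≤∣p∣+∣q∣ p q) (+-monoʳ-≤ ∣ p ∣ (n≤1+n ∣ q ∣)))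
∣p∪q∣≤∣p∣+∣q∣ (true  ∷ p) (false ∷ q) = s≤s (∣p∪q∣≤∣p∣+∣q∣ p q)
∣p∪q∣≤∣p∣+∣q∣ (false ∷ p) (true  ∷ q) rewrite +-suc ∣ p ∣ ∣ q ∣ = s≤s (∣p∪q∣≤∣p∣+∣q∣ p q)
∣p∪q∣≤∣p∣+∣q∣ (false ∷ p) (false ∷ q) = ∣p∪q∣≤∣p∣+∣q∣ p q

∣⁅x⁆∪p∣≤1+∣p∣ : ∀ {n} (x : Fin n) (p : Subset n) → ∣ ⁅ x ⁆ ∪ p ∣ ≤ suc ∣ p ∣
∣⁅x⁆∪p∣≤1+∣p∣ x p = subst (λ c → ∣ ⁅ x ⁆ ∪ p ∣ ≤ c + ∣ p ∣) (∣⁅x⁆∣≡1 x) (∣p∪q∣≤∣p∣+∣q∣ ⁅ x ⁆ p)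

fromList : ∀ {n} → List (Fin n) → Subset n
fromList []       = ∅
fromList (x ∷ xs) = ⁅ x ⁆ ∪ fromList xs

∈-fromList⁺ : ∀ {n} {a : Fin n} xs → a List.∈ xs → a ∈ fromList xs
∈-fromList⁺ (x ∷ xs) (here refl) = x∈p∪q⁺ (inj₁ (x∈⁅x⁆ x))
∈-fromList⁺ (x ∷ xs) (there a∈) = x∈p∪q⁺ (inj₂ (∈-fromList⁺ xs a∈))

∈-fromList⁻ : ∀ {n} {a : Fin n} xs → a ∈ fromList xs → a List.∈ xs
∈-fromList⁻ []       a∈ = ⊥-elim (∉⊥ a∈)
∈-fromList⁻ (x ∷ xs) a∈ with x∈p∪q⁻ ⁅ x ⁆ (fromList xs) a∈
... | inj₁ a∈⁅x⁆ = here (x∈⁅y⁆⇒x≡y x a∈⁅x⁆)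
... | inj₂ a∈xs  = there (∈-fromList⁻ xs a∈xs)

∣fromList∣≤length : ∀ {n} (xs : List (Fin n)) → ∣ fromList xs ∣ ≤ length xs
∣fromList∣≤length {n} []       = ≤-reflexive (∣⊥∣≡0 n)
∣fromList∣≤length (x ∷ xs) = ≤-trans (∣⁅x⁆∪p∣≤1+∣p∣ x (fromList xs)) (s≤s (∣fromList∣≤length xs))

Unique⇒lookup-injective : ∀ {a} {A : Set a} {xs : List A} → Unique xs →
  ∀ i j → lookup xs i ≡ lookup xs j → i ≡ j
Unique⇒lookup-injective (_ ∷ _)  zero    zero    _ = refl
Unique⇒lookup-injective (x∉ ∷ _) zero    (suc j) e = ⊥-elim (All-lookup x∉ (∈-lookup j) e)
Unique⇒lookup-injective (x∉ ∷ _) (suc i) zero    e = ⊥-elim (All-lookup x∉ (∈-lookup i) (≡-sym e))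
Unique⇒lookup-injective (_ ∷ u)  (suc i) (suc j) e = cong suc (Unique⇒lookup-injective u i j e)

Unique⇒length≤ : ∀ {n} {xs : List (Fin n)} → Unique xs → length xs ≤ n
Unique⇒length≤ {n} {xs} u with length xs ≤? n
... | yes ≤n = ≤n
... | no ≰n with pigeonhole (≰⇒> ≰n) (lookup xs)
... | i , j , i<j , e = ⊥-elim (<⇒≢ i<j (cong toℕ (Unique⇒lookup-injective u i j e)))

lookup-take-∷ʳ : ∀ {a} {A : Set a} (xs : List A) y (i : Fin (length (xs ∷ʳ y))) →
  (∃ λ (j : Fin (length xs)) → toℕ j ≡ toℕ i × lookup (xs ∷ʳ y) i ≡ lookup xs j ×
                                take (toℕ i) (xs ∷ʳ y) ≡ take (toℕ j) xs)
  ⊎ (lookup (xs ∷ʳ y) i ≡ y × take (toℕ i) (xs ∷ʳ y) ≡ xs)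
lookup-take-∷ʳ []       y zero    = inj₂ (refl , refl)
lookup-take-∷ʳ (x ∷ xs) y zero    = inj₁ (zero , refl , refl , refl)
lookup-take-∷ʳ (x ∷ xs) y (suc i) with lookup-take-∷ʳ xs y i
... | inj₁ (j , i≡j , entry , prefix) = inj₁ (suc j , cong suc i≡j , entry , cong (x ∷_) prefix)
... | inj₂ (entry , prefix)           = inj₂ (entry , cong (x ∷_) prefix)

module _ {n} (G : Graph n) (W : Subset n) where

  NewNeighbour : List (Fin n) → Fin n → Set
  NewNeighbour xs y = ∃ λ w → w ∈ W × Adj G y w × All (λ z → ¬ Adj G z w) xs

  StronglyLegal : List (Fin n) → Set
  StronglyLegal xs = ∀ i → NewNeighbour (take (toℕ i) xs) (lookup xs i)

  Legal⇒StronglyLegal : NoIsolated G W → ∀ {xs} → All (_∈ W) xs → Legal G W xs → StronglyLegal xs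
  Legal⇒StronglyLegal noIso (x∈W ∷ _) _ zero with noIso _ x∈W
  ... | w , w∈W , xw = w , w∈W , xw , []
  Legal⇒StronglyLegal noIso {_ ∷ _} _ legal (suc i) = legal (suc i) (s≤s z≤n)

  Legal-∷ʳ : ∀ {xs y} → Legal G W xs → NewNeighbour xs y → Legal G W (xs ∷ʳ y)
  Legal-∷ʳ {xs} {y} legal new i 0<i with lookup-take-∷ʳ xs y i
  ... | inj₁ (j , j≡i , entry , prefix) rewrite entry | prefix = legal j (subst (0 <_) (≡-sym j≡i) 0<i)
  ... | inj₂ (entry , prefix)           rewrite entry | prefix = new

  IsTDSeq⇒IsTDS : ∀ {xs} → IsTDSeq G W xs → IsTDS G W (fromList xs)
  IsTDSeq⇒IsTDS {xs} (_ , xs⊆W , _ , dom) =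
    (λ a∈ → All-lookup xs⊆W (∈-fromList⁻ xs a∈)) ,
    (λ v v∈W → let a , a∈ , va = dom v v∈W in a , ∈-fromList⁺ xs a∈ , va)

  IsTDSeq⇒γₜ≤length : ∀ {k} → (∀ A → IsTDS G W A → k ≤ ∣ A ∣) → ∀ {xs} → IsTDSeq G W xs → k ≤ length xs
  IsTDSeq⇒γₜ≤length γₜ-min {xs} tds = ≤-trans (γₜ-min _ (IsTDSeq⇒IsTDS tds)) (∣fromList∣≤length xs)

module GreedyExtension {n} (G : Graph n) (W : Subset n) (noIso : NoIsolated G W) where

  Candidate : List (Fin n) → Fin n → Set
  Candidate xs y = y ∈ W × ¬ y List.∈ xs × NewNeighbour G W xs y

  candidate? : ∀ xs y → Dec (Candidate xs y)
  candidate? xs y =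
    (y ∈ˢ? W) ×-dec ¬? (anyˡ? (y ≟_) xs) ×-dec
    any? (λ w → (w ∈ˢ? W) ×-dec Adj? G y w ×-dec all? (λ z → ¬? (Adj? G z w)) xs)

  no-candidate⇒dominating : ∀ {xs} → ¬ ∃ (Candidate xs) → TotDominated G W (List._∈ xs)
  no-candidate⇒dominating {xs} stuck v v∈W with noIso v v∈W
  ... | y , y∈W , vy with anyˡ? (y ≟_) xs
  ...   | yes y∈xs = y , y∈xs , vy
  ...   | no y∉xs with anyˡ? (λ a → Adj? G a v) xs
  ...     | yes dominated = let a , a∈xs , av = List.find dominated in a , a∈xs , Adj-sym G av
  ...     | no undominated =
    ⊥-elim (stuck (y , y∈W , y∉xs , v , v∈W , Adj-sym G vy , ¬Any⇒All¬ xs undominated))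

  -- The fuel suffices because the sequence stays duplicate-free (Unique⇒length≤).
  extend : ∀ fuel {xs} → n < length xs + fuel → Unique xs → All (_∈ W) xs → Legal G W xs →
    ∃ λ ys → IsTDSeq G W (xs ++ ys)
  extend zero {xs} enough unique _ _ =
    ⊥-elim (<⇒≱ (subst (n <_) (+-identityʳ (length xs)) enough) (Unique⇒length≤ unique))
  extend (suc fuel) {xs} enough unique xs⊆W legal with any? (candidate? xs)
  ... | yes (y , y∈W , y∉xs , new) =
    let ys , tds = extend fuel enough′ unique′ (All-++⁺ xs⊆W (y∈W ∷ [])) (Legal-∷ʳ G W legal new)
    in y ∷ ys , subst (IsTDSeq G W) (++-assoc xs [ y ] ys) tds
    where
    enough′ : n < length (xs ∷ʳ y) + fuel
    enough′ = subst (n <_) (≡-sym (trans (cong (_+ fuel) (length-++ xs)) (+-assoc (length xs) 1 fuel))) enough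
    unique′ : Unique (xs ∷ʳ y)
    unique′ = Unique-++⁺ unique ([] ∷ []) (λ { (y∈xs , here refl) → y∉xs y∈xs })
  ... | no stuck =
    [] , subst (IsTDSeq G W) (≡-sym (++-identityʳ xs)) (unique , xs⊆W , legal , no-candidate⇒dominating stuck)

  extend-to-TDSeq : ∀ {xs} → Unique xs → All (_∈ W) xs → Legal G W xs → ∃ λ ys → IsTDSeq G W (xs ++ ys)
  extend-to-TDSeq {xs} = extend (suc n) (≤-trans (n<1+n n) (m≤n+m (suc n) (length xs)))

  Legal⇒length≤γgrₜ : ∀ {k} → (∀ xs → IsTDSeq G W xs → length xs ≤ k) →
    ∀ {xs} → Unique xs → All (_∈ W) xs → Legal G W xs → length xs ≤ k
  Legal⇒length≤γgrₜ γgrₜ-max {xs} unique xs⊆W legal =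
    let ys , tds = extend-to-TDSeq unique xs⊆W legal in ≤-trans (length-++-≤ˡ xs) (γgrₜ-max _ tds)

bounds⇒TotalUniform : ∀ {n} (G : Graph n) (W : Subset n) {m} → NoIsolated G W →
  (∀ A → IsTDS G W A → m ≤ ∣ A ∣) → (∀ xs → IsTDSeq G W xs → length xs ≤ m) → TotalUniform G W m
bounds⇒TotalUniform G W noIso γₜ≥ γgrₜ≤
  with GreedyExtension.extend-to-TDSeq G W noIso [] [] (λ ())
... | S , seq = noIso ,
  ((fromList S , tds , ≤-antisym (≤-trans (∣fromList∣≤length S) (γgrₜ≤ S seq)) (γₜ≥ _ tds)) , γₜ≥) ,
  ((S , seq , ≤-antisym (γgrₜ≤ S seq) (≤-trans (γₜ≥ _ tds) (∣fromList∣≤length S))) , γgrₜ≤)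
  where
  tds : IsTDS G W (fromList S)
  tds = IsTDSeq⇒IsTDS G W seq

OutsideNbhds : ∀ {n} → Graph n → Fin n → Fin n → Subset n
OutsideNbhds G u v = ∁ (ClosedNbhd G u ∪ ClosedNbhd G v)

module _ {n} (G : Graph n) {u v : Fin n} where

  private
    W : Subset n
    W = OutsideNbhds G u v

  ∈W⇒∉N[u] : ∀ {y} → y ∈ W → ¬ (y ≡ u ⊎ Adj G u y)
  ∈W⇒∉N[u] y∈W y∈N[u] = x∈∁p⇒x∉p y∈W (x∈p∪q⁺ (inj₁ (∈-ClosedNbhd⁺ G y∈N[u])))

  ∈W⇒∉N[v] : ∀ {y} → y ∈ W → ¬ (y ≡ v ⊎ Adj G v y)
  ∈W⇒∉N[v] y∈W y∈N[v] = x∈∁p⇒x∉p y∈W (x∈p∪q⁺ (inj₂ (∈-ClosedNbhd⁺ G y∈N[v])))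

  ∉W⇒∈N[u]∪N[v] : ∀ {y} → y ∉ W → (y ≡ u ⊎ Adj G u y) ⊎ (y ≡ v ⊎ Adj G v y)
  ∉W⇒∈N[u]∪N[v] y∉W with x∈p∪q⁻ (ClosedNbhd G u) (ClosedNbhd G v) (x∉∁p⇒x∈p y∉W)
  ... | inj₁ y∈N[u] = inj₁ (∈-ClosedNbhd⁻ G y∈N[u])
  ... | inj₂ y∈N[v] = inj₂ (∈-ClosedNbhd⁻ G y∈N[v])

  isolated⇒N⊆N[u]∪N[v] : ∀ {x} → x ∈ W → ¬ ∃ (λ w → w ∈ W × Adj G x w) →
    ∀ {w} → ¬ Adj G u w → ¬ Adj G v w → ¬ Adj G x w
  isolated⇒N⊆N[u]∪N[v] {x} x∈W isolated {w} ¬uw ¬vw xw with ∉W⇒∈N[u]∪N[v] (λ w∈W → isolated (w , w∈W , xw))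
  ... | inj₁ (inj₁ refl) = ∈W⇒∉N[u] x∈W (inj₂ (Adj-sym G xw))
  ... | inj₁ (inj₂ uw)   = ¬uw uw
  ... | inj₂ (inj₁ refl) = ∈W⇒∉N[v] x∈W (inj₂ (Adj-sym G xw))
  ... | inj₂ (inj₂ vw)   = ¬vw vw

  module _ (uv : Adj G u v) where

    Unique-uv∷ : ∀ {xs} → All (_∈ W) xs → Unique xs → Unique (u ∷ v ∷ xs)
    Unique-uv∷ xs⊆W unique =
      (u≢v ∷ All.map (λ y∈W u≡y → ∈W⇒∉N[u] y∈W (inj₁ (≡-sym u≡y))) xs⊆W) ∷
      All.map (λ y∈W v≡y → ∈W⇒∉N[v] y∈W (inj₁ (≡-sym v≡y))) xs⊆W ∷ unique
      where
      u≢v : ¬ u ≡ v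
      u≢v refl = Adj-irrefl G uv

    Legal-uv∷ : ∀ {xs} → StronglyLegal G W xs → Legal G ⊤ (u ∷ v ∷ xs)
    Legal-uv∷ _     (suc zero)    _ = u , ∈⊤ , Adj-sym G uv , Adj-irrefl G ∷ []
    Legal-uv∷ legal (suc (suc i)) _ with legal i
    ... | w , w∈W , xw , new = w , ∈⊤ , xw , (∈W⇒∉N[u] w∈W ∘ inj₂) ∷ (∈W⇒∉N[v] w∈W ∘ inj₂) ∷ new

    IsTDS-⁅u⁆∪⁅v⁆∪ : ∀ {A} → IsTDS G W A → IsTDS G ⊤ (⁅ u ⁆ ∪ (⁅ v ⁆ ∪ A))
    IsTDS-⁅u⁆∪⁅v⁆∪ {A} (_ , dom) = (λ _ → ∈⊤) , dom′
      where
      u∈ : u ∈ ⁅ u ⁆ ∪ (⁅ v ⁆ ∪ A)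
      u∈ = x∈p∪q⁺ (inj₁ (x∈⁅x⁆ u))
      v∈ : v ∈ ⁅ u ⁆ ∪ (⁅ v ⁆ ∪ A)
      v∈ = x∈p∪q⁺ (inj₂ (x∈p∪q⁺ (inj₁ (x∈⁅x⁆ v))))
      dom′ : TotDominated G ⊤ (_∈ ⁅ u ⁆ ∪ (⁅ v ⁆ ∪ A))
      dom′ y _ with y ∈ˢ? W
      ... | yes y∈W = let a , a∈A , ya = dom y y∈W in a , x∈p∪q⁺ (inj₂ (x∈p∪q⁺ (inj₂ a∈A))) , ya
      ... | no y∉W with ∉W⇒∈N[u]∪N[v] y∉W
      ...   | inj₁ (inj₁ refl) = v , v∈ , uv
      ...   | inj₁ (inj₂ uy)   = u , u∈ , Adj-sym G uy
      ...   | inj₂ (inj₁ refl) = u , u∈ , Adj-sym G uv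
      ...   | inj₂ (inj₂ vy)   = v , v∈ , Adj-sym G vy

    module _ {x} (x∈W : x ∈ W) (covered : ∀ {w} → ¬ Adj G u w → ¬ Adj G v w → ¬ Adj G x w) {ys}
             (legal : Legal G ⊤ (u ∷ v ∷ ys)) where

      Legal-x∷uv∷ : Legal G ⊤ (x ∷ u ∷ v ∷ ys)
      Legal-x∷uv∷ (suc zero)          _ = v , ∈⊤ , uv , (∈W⇒∉N[v] x∈W ∘ inj₂ ∘ Adj-sym G) ∷ []
      Legal-x∷uv∷ (suc (suc zero))    _ =
        u , ∈⊤ , Adj-sym G uv , (∈W⇒∉N[u] x∈W ∘ inj₂ ∘ Adj-sym G) ∷ Adj-irrefl G ∷ []
      Legal-x∷uv∷ (suc (suc (suc j))) _ with legal (suc (suc j)) (s≤s z≤n)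
      ... | w , _ , yw , ¬uw ∷ ¬vw ∷ new = w , ∈⊤ , yw , covered ¬uw ¬vw ∷ ¬uw ∷ ¬vw ∷ new

      Unique-x∷uv∷ : Unique (u ∷ v ∷ ys) → Unique (x ∷ u ∷ v ∷ ys)
      Unique-x∷uv∷ unique = ((∈W⇒∉N[u] x∈W ∘ inj₁) ∷ (∈W⇒∉N[v] x∈W ∘ inj₁) ∷ All.tabulate x∉ys) ∷ unique
        where
        -- every y ∈ ys has a neighbour outside N(u) ∪ N(v), and x has none
        x∉ys : ∀ {y} → y List.∈ ys → ¬ x ≡ y
        x∉ys y∈ys refl with legal (suc (suc (index y∈ys))) (s≤s z≤n)
        ... | w , _ , yw , ¬uw ∷ ¬vw ∷ _ =
          covered ¬uw ¬vw (subst (λ z → Adj G z w) (≡-sym (lookup-index y∈ys)) yw)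

module OutsideBounds {n k} (G : Graph n) (noIso : NoIsolated G ⊤)
         (γₜ-min : ∀ A → IsTDS G ⊤ A → k ≤ ∣ A ∣) (γgrₜ-max : ∀ xs → IsTDSeq G ⊤ xs → length xs ≤ k)
         {u v : Fin n} (uv : Adj G u v) where

  open GreedyExtension G ⊤ noIso

  private
    W : Subset n
    W = OutsideNbhds G u v

  Legal⇒length≤k : ∀ {xs} → Unique xs → Legal G ⊤ xs → length xs ≤ k
  Legal⇒length≤k {xs} unique = Legal⇒length≤γgrₜ γgrₜ-max unique (All.universal (λ _ → ∈⊤) xs)

  Outside-noIsolated : NoIsolated G W
  Outside-noIsolated x x∈W with any? (λ w → (w ∈ˢ? W) ×-dec Adj? G x w)
  ... | yes nbr = nbr
  ... | no isolated
    with extend-to-TDSeq (Unique-uv∷ G uv [] []) (All.universal (λ _ → ∈⊤) _) (Legal-uv∷ G uv (λ ()))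
  ...   | ys , tds@(unique , _ , legal , _) =
    ⊥-elim (<⇒≱ (Legal⇒length≤k (Unique-x∷uv∷ G uv x∈W covered legal unique) (Legal-x∷uv∷ G uv x∈W covered legal))
                (IsTDSeq⇒γₜ≤length G ⊤ γₜ-min tds))
    where
    covered : ∀ {w} → ¬ Adj G u w → ¬ Adj G v w → ¬ Adj G x w
    covered = isolated⇒N⊆N[u]∪N[v] G x∈W isolated

  Outside-γgrₜ≤ : ∀ xs → IsTDSeq G W xs → length xs ≤ k ∸ 2
  Outside-γgrₜ≤ xs (unique , xs⊆W , legal , _) = ∸-monoˡ-≤ 2
    (Legal⇒length≤k (Unique-uv∷ G uv xs⊆W unique) (Legal-uv∷ G uv (Legal⇒StronglyLegal G W Outside-noIsolated xs⊆W legal)))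

  Outside-γₜ≥ : ∀ A → IsTDS G W A → k ∸ 2 ≤ ∣ A ∣
  Outside-γₜ≥ A tds = ∸-monoˡ-≤ 2 (≤-trans (γₜ-min _ (IsTDS-⁅u⁆∪⁅v⁆∪ G uv tds))
    (≤-trans (∣⁅x⁆∪p∣≤1+∣p∣ u (⁅ v ⁆ ∪ A)) (s≤s (∣⁅x⁆∪p∣≤1+∣p∣ v A))))

lemma2p2 : (n k : ℕ) → 3 ≤ k → (G : Graph n) → TotalUniform G ⊤ k →
    (u v : Fin n) → Adj G u v →
    TotalUniform G (∁ (ClosedNbhd G u ∪ ClosedNbhd G v)) (k ∸ 2)
lemma2p2 n k _ G (noIso , (_ , γₜ-min) , (_ , γgrₜ-max)) u v uv =
  bounds⇒TotalUniform G (OutsideNbhds G u v) Outside-noIsolated Outside-γₜ≥ Outside-γgrₜ≤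
  where open OutsideBounds G noIso γₜ-min γgrₜ-max uv
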